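{- Let $x$ be a node of a top tree in which all clusters are valid and the orientation invariant holds. For $i \geq 0$ let $p_i(x)$ denote the $i$-th ancestor of $x$ (with $p_0(x)=x$), or the root if $i \geq \mathrm{depth}(x)$. Consider the operation $\mathrm{semi\_splay\_step}(p_k(x))$, and let $x'$ denote the node $x$ after this operation. Let $0 \leq k \leq b$ and $0 \leq a \leq k+1$ be integers such that $\mathrm{semi\_splay\_step}(p_k(x))$ returns $p_\ell(x')$ for some $\ell \leq b$ (this is the same node as $p_{\ell+1}(x)$). Then the operation changes the potential by $$\Delta\Phi = r(\mathrm{sibling}(p_{\ell-1}(x'))) + \sum_{i=a}^{b-1} r(p_i(x')) - \sum_{i=a}^{b} r(p_i(x)).$$
   Context: Let $F$ be a forest (the underlying forest) in which some vertices are marked as exposed. For a set $C$ of edges of $F$, a vertex $w$ is a boundary vertex of $C$ if $w$ is incident to an edge of $C$ and either $w$ is exposed or $w$ is incident to an edge of $F$ not in $C$. A cluster is a nonempty connected set of edges; it is valid if it has at most two boundary vertices; a valid cluster is a path cluster if it has exactly two boundary vertices and a point cluster if it has zero or one. A top tree for a tree $T$ of $F$ (with at least one edge) is a rooted tree in which every internal node has exactly two children and whose leaves are in bijection with the edges of $T$; each node is identified with the cluster of edges at the leaves of its subtree, every such cluster being connected and valid. The two children of an internal node share exactly one vertex, its central vertex. The depth of a node is its distance to the root (the root has depth $0$). Potential: for a node $y$, $s(y)$ is the number of leaves in the subtree rooted at $y$, $r(y)=\log_2 s(y)$, and $\Phi=\sum_{\mathcal T}\sum_{y\in\mathcal T}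 r(y)$, summing over all top trees $\mathcal T$ of the forest and all their nodes. Orientation: each internal node has ordered children (left, right), each leaf has ordered endpoints (left, right). For a leaf, a boundary vertex is its left/right boundary vertex if it is its left/right endpoint; for an internal node, a boundary vertex is middle if it equals the central vertex, and otherwise left/right according to whether it is a boundary vertex of the left/right child. Leftmost boundary vertex: the left one if it exists, else the middle one if it exists, else none; rightmost symmetric. Orientation invariant: for every internal node, the rightmost boundary vertex of the left child and the leftmost boundary vertex of the right child exist and equal the central vertex. Two nodes hang off to the same side if both are left children or both are right children of their respective parents. Rotation: for a node $u$ with parent $y$ and grandparent $z$, with $a=\mathrm{sibling}(u)$, $b=\mathrm{sibling}(y)$, $\mathrm{rotate\_up}(u)$ is allowed iff $a\cup b$ is a valid cluster; it makes $a,b$ the children of $y$ and $u,y$ the children of $z$ (other parent–child relations unchanged), then adjusts child orders and orientations (possibly reversing orientations of whole subtrees) so that the orientation invariant holds. Semi-splay step: $\mathrm{semi\_splay\_step}(x)$ does the following. Let $p$ be the parent and $g$ the grandparent of $x$; if either does not exist, return null without changes. If $x$ and $g$ are both point clusters, perform $\mathrm{rotate\_up}(x)$ and return $g$. Otherwise let $gg$ be the parent of $g$; if it does not exist, return null. If $p$ is a path cluster and ($g$ is a path cluster or $gg$ is a point cluster), then: if $x$ and $p$ hang off to the same side, perform $\mathrm{rotate\_up}(x)$ and return $g$; else if $p$ and $g$ hang off to the same side, perform $\mathrm{rotate\_up}(p)$ and return $gg$; else (then $x$ and $g$ hang off to the same side) perform $\mathrm{rotate\_up}(\mathrm{sibling}(x))$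 followed by $\mathrm{rotate\_up}(p)$ and return $gg$. In all remaining cases, return $\mathrm{semi\_splay\_step}(p)$. -}

module Defs where

open import Data.Nat using (ℕ; zero; suc; _+_; _*_; _∸_; _≤_; _≡ᵇ_; _≤ᵇ_; _≟_)
open import Data.Bool using (Bool; true; false; _∨_; _∧_; not; if_then_else_)
open import Data.List using (List; []; _∷_; _++_; length; concatMap; map; filterᵇ;
  deduplicate; take; reverse; head)
open import Data.Bool.ListAction using (any)
open import Data.Nat.ListAction using (product)
open import Data.List.Membership.Propositional using (_∈_)
open import Data.List.Relation.Unary.All using (All)
open import Data.List.Relation.Unary.Unique.Propositional using (Unique)
open import Data.Maybe using (Maybe; just; nothing; maybe; _<∣>_)
import Data.Maybe as M
open import Data.Product using (_×_; ∃-syntax; Σ-syntax)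
open import Data.Sum using (_⊎_)
open import Data.Unit using (⊤)
open import Relation.Nullary using (¬_)
open import Relation.Binary.PropositionalEquality using (_≡_; _≢_)

-- Edges of the underlying forest, with a unique identifier.
-- (eid, left endpoint, right endpoint); the endpoint order of a leaf is
-- the leaf's orientation.

record Edge : Set where
  constructor edge
  field
    eid eu ev : ℕ
open Edge public

-- Every node carries a unique identifier (so that "the node
-- x after the operation" can be tracked).  A leaf carries its edge with
-- ordered endpoints (left, right); an internal node has ordered children
-- (left, right).  Hence the data encodes the orientation.

data Tree : Set where
  leaf : (i u v : ℕ) → Tree
  node : (i : ℕ) → (l r : Tree) → Tree

idOf : Tree → ℕ
idOf (leaf i _ _) = i
idOf (node i _ _) = i

ids : Tree → List ℕ
ids (leaf i _ _) = i ∷ []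
ids (node i l r) = i ∷ ids l ++ ids r

-- the cluster of a node = edges at the leaves of its subtree
edges : Tree → List Edge
edges (leaf i u v) = edge i u v ∷ []
edges (node _ l r) = edges l ++ edges r

size : Tree → ℕ
size T = length (edges T)

-- Navigation: a node is addressed by its path from the root.

data Dir : Set where
  L R : Dir

flip : Dir → Dir
flip L = R
flip R = L

pick : {A : Set} → Dir → A → A → A
pick L a b = a
pick R a b = b

subAt : Tree → List Dir → Maybe Tree
subAt T [] = just T
subAt (leaf _ _ _) (_ ∷ _) = nothing
subAt (node _ l r) (L ∷ p) = subAt l p
subAt (node _ l r) (R ∷ p) = subAt r p

replaceAt : Tree → List Dir → Tree → Tree
replaceAt T [] S = S
replaceAt (leaf i u v) (_ ∷ _) S = leaf i u v
replaceAt (node i l r) (L ∷ p) S = node i (replaceAt l p S) r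
replaceAt (node i l r) (R ∷ p) S = node i l (replaceAt r p S)

pathTo : ℕ → Tree → Maybe (List Dir)
pathTo x (leaf i _ _) = if x ≡ᵇ i then just [] else nothing
pathTo x (node i l r) =
  if x ≡ᵇ i then just [] else (M.map (L ∷_) (pathTo x l) <∣> M.map (R ∷_) (pathTo x r))

idAt : Tree → List Dir → Maybe ℕ
idAt T p = M.map idOf (subAt T p)

-- p_i : the i-th ancestor (the root if i ≥ depth)
anc : ℕ → List Dir → List Dir
anc i q = take (length q ∸ i) q

sibPath : List Dir → Maybe (List Dir)
sibPath q with reverse q
... | [] = nothing
... | d ∷ rest = just (reverse rest ++ flip d ∷ [])

szAt : Tree → List Dir → ℕ
szAt T p = maybe size 0 (subAt T p)

szSib : Tree → List Dir → ℕ
szSib T p = maybe (szAt T) 0 (sibPath p)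

incident : ℕ → Edge → Bool
incident w e = (w ≡ᵇ eu e) ∨ (w ≡ᵇ ev e)

memId : List Edge → Edge → Bool
memId C e = any (λ c → eid c ≡ᵇ eid e) C

vertsOf : List Edge → List ℕ
vertsOf C = deduplicate _≟_ (concatMap (λ e → eu e ∷ ev e ∷ []) C)

data Reach (C : List Edge) : ℕ → ℕ → Set where
  here : ∀ {w} → Reach C w w
  step : ∀ {w v t} (e : Edge) → e ∈ C →
         ((eu e ≡ w × ev e ≡ v) ⊎ (ev e ≡ w × eu e ≡ v)) →
         Reach C v t → Reach C w t

Connected : List Edge → Set
Connected C = ∀ e e' → e ∈ C → e' ∈ C → Reach C (eu e) (eu e')

Acyclic : List Edge → Set
Acyclic F = ∀ e → e ∈ F → ¬ Reach (filterᵇ (λ f → not (eid f ≡ᵇ eid e)) F) (eu e) (ev e)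

sharedVerts : List Edge → List Edge → List ℕ
sharedVerts C D = filterᵇ (λ w → any (w ≡ᵇ_) (vertsOf D)) (vertsOf C)

data AllSub (P : Tree → Set) : Tree → Set where
  leafA : ∀ {i u v} → P (leaf i u v) → AllSub P (leaf i u v)
  nodeA : ∀ {i l r} → P (node i l r) → AllSub P l → AllSub P r → AllSub P (node i l r)

Inner : (ℕ → Tree → Tree → Set) → Tree → Set
Inner P (leaf _ _ _) = ⊤
Inner P (node i l r) = P i l r

-- Reorientation: equality up to swapping children orders and leaf endpoints.
data _≅_ : Tree → Tree → Set where
  leafSame : ∀ {i u v} → leaf i u v ≅ leaf i u v
  leafFlip : ∀ {i u v} → leaf i u v ≅ leaf i v u
  nodeSame : ∀ {i A A' B B'} → A ≅ A' → B ≅ B' → node i A B ≅ node i A' B'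
  nodeSwap : ∀ {i A A' B B'} → A ≅ A' → B ≅ B' → node i A B ≅ node i B' A'

-- Notions relative to the forest: Fe = all edges of F, ex = exposed marks.

module Ctx (Fe : List Edge) (ex : ℕ → Bool) where

  isBnd : List Edge → ℕ → Bool
  isBnd C w = ex w ∨ any (λ e → not (memId C e) ∧ incident w e) Fe

  bnd : List Edge → List ℕ
  bnd C = filterᵇ (isBnd C) (vertsOf C)

  IsCluster : List Edge → Set
  IsCluster C = C ≢ [] × Connected C

  Valid : List Edge → Set
  Valid C = IsCluster C × length (bnd C) ≤ 2

  IsPoint : List Edge → Set
  IsPoint C = Valid C × length (bnd C) ≤ 1

  IsPath : List Edge → Set
  IsPath C = Valid C × length (bnd C) ≡ 2

  elem : ℕ → List ℕ → Bool
  elem w xs = any (w ≡ᵇ_) xs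

  central : Tree → Tree → Maybe ℕ
  central l r = head (sharedVerts (edges l) (edges r))

  isC : Maybe ℕ → ℕ → Bool
  isC c w = maybe (w ≡ᵇ_) false c

  leftmost : Tree → Maybe ℕ
  leftmost (leaf i u v) = if elem u (bnd (edge i u v ∷ [])) then just u else nothing
  leftmost (node i l r) =
    head (filterᵇ (λ w → not (isC (central l r) w) ∧ elem w (bnd (edges l))) B)
    <∣> head (filterᵇ (isC (central l r)) B)
    where B = bnd (edges (node i l r))

  rightmost : Tree → Maybe ℕ
  rightmost (leaf i u v) = if elem v (bnd (edge i u v ∷ [])) then just v else nothing
  rightmost (node i l r) =
    head (filterᵇ (λ w → not (isC (central l r) w) ∧ elem w (bnd (edges r))) B)
    <∣> head (filterᵇ (isC (central l r)) B)
    where B = bnd (edges (node i l r))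

  OI : Tree → Set
  OI = AllSub (Inner (λ _ l r → Σ[ c ∈ ℕ ] (central l r ≡ just c × rightmost l ≡ just c × leftmost r ≡ just c)))

  IsTopTree : Tree → Set
  IsTopTree T =
    AllSub (λ S → Valid (edges S)) T ×
    AllSub (Inner (λ _ l r → length (sharedVerts (edges l) (edges r)) ≡ 1)) T ×
    (∀ e → e ∈ Fe → (∃[ w ] (w ∈ vertsOf (edges T) × incident w e ≡ true)) → memId (edges T) e ≡ true)

  -- rotate_up(u) in T (u given by identifier), with any reorientation
  -- restoring the orientation invariant
  data Rot (T : Tree) (u : ℕ) (T' : Tree) : Set where
    rot : (q : List Dir) (d1 d2 : Dir) (zid yid : ℕ) (Z1 Z2 Y1 Y2 : Tree) →
      pathTo u T ≡ just (q ++ d1 ∷ d2 ∷ []) →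
      subAt T q ≡ just (node zid Z1 Z2) →
      pick d1 Z1 Z2 ≡ node yid Y1 Y2 →
      Valid (edges (pick (flip d2) Y1 Y2) ++ edges (pick (flip d1) Z1 Z2)) →
      T' ≅ replaceAt T q (node zid (pick d2 Y1 Y2)
                                   (node yid (pick (flip d2) Y1 Y2) (pick (flip d1) Z1 Z2))) →
      OI T' →
      Rot T u T'

  Loc4 : Tree → ℕ → List Dir → Dir → Dir → Dir → Tree → Tree → Tree → Tree → Set
  Loc4 T x q d0 d1 d2 X P G GG =
    pathTo x T ≡ just (q ++ d0 ∷ d1 ∷ d2 ∷ []) ×
    subAt T (q ++ d0 ∷ d1 ∷ d2 ∷ []) ≡ just X ×
    subAt T (q ++ d0 ∷ d1 ∷ []) ≡ just P ×
    subAt T (q ++ d0 ∷ []) ≡ just G ×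
    subAt T q ≡ just GG

  NotZig : Tree → Tree → Set
  NotZig X G = ¬ (IsPoint (edges X) × IsPoint (edges G))

  Cond : Tree → Tree → Tree → Set
  Cond P G GG = IsPath (edges P) × (IsPath (edges G) ⊎ IsPoint (edges GG))

  -- Step T x T' r : semi_splay_step(x) on T may produce T' and return r
  data Step (T : Tree) (x : ℕ) : Tree → Maybe ℕ → Set where
    noParent : pathTo x T ≡ just [] → Step T x T nothing
    noGrand : ∀ d → pathTo x T ≡ just (d ∷ []) → Step T x T nothing
    zig : ∀ q d1 d2 X G T' →
      pathTo x T ≡ just (q ++ d1 ∷ d2 ∷ []) →
      subAt T (q ++ d1 ∷ d2 ∷ []) ≡ just X → subAt T q ≡ just G →
      IsPoint (edges X) → IsPoint (edges G) →
      Rot T x T' → Step T x T' (just (idOf G))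
    noGGparent : ∀ d1 d2 X G →
      pathTo x T ≡ just (d1 ∷ d2 ∷ []) →
      subAt T (d1 ∷ d2 ∷ []) ≡ just X → subAt T [] ≡ just G →
      NotZig X G → Step T x T nothing
    case1 : ∀ q d0 d1 d2 X P G GG T' → Loc4 T x q d0 d1 d2 X P G GG →
      NotZig X G → Cond P G GG → d2 ≡ d1 →
      Rot T x T' → Step T x T' (just (idOf G))
    case2 : ∀ q d0 d1 d2 X P G GG T' → Loc4 T x q d0 d1 d2 X P G GG →
      NotZig X G → Cond P G GG → d2 ≢ d1 → d1 ≡ d0 →
      Rot T (idOf P) T' → Step T x T' (just (idOf GG))
    case3 : ∀ q d0 d1 d2 X P G GG S T1 T' → Loc4 T x q d0 d1 d2 X P G GG →
      NotZig X G → Cond P G GG → d2 ≢ d1 → d1 ≢ d0 →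
      subAt T (q ++ d0 ∷ d1 ∷ flip d2 ∷ []) ≡ just S →
      Rot T (idOf S) T1 → Rot T1 (idOf P) T' → Step T x T' (just (idOf GG))
    recurse : ∀ q d0 d1 d2 X P G GG T' r → Loc4 T x q d0 d1 d2 X P G GG →
      NotZig X G → ¬ Cond P G GG →
      Step T (idOf P) T' r → Step T x T' r

-- The forest: a list of top trees (one per tree of F with ≥ 1 edge);
-- the edges of F are the leaves of these top trees.

allEdges : List Tree → List Edge
allEdges ts = concatMap edges ts

IsTopForest : (ℕ → Bool) → List Tree → Set
IsTopForest ex ts =
  Unique (concatMap ids ts) × Acyclic (allEdges ts) × All (Ctx.IsTopTree (allEdges ts) ex) ts

-- Potential, exponentiated: 2^Φ = product over all nodes of s(y).

prodNodes : Tree → ℕ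
prodNodes (leaf _ _ _) = 1
prodNodes (node i l r) = size (node i l r) * prodNodes l * prodNodes r

expΦ : List Tree → ℕ
expΦ ts = product (map prodNodes ts)

prodRange : (ℕ → ℕ) → ℕ → ℕ → ℕ
prodRange f a zero = 1
prodRange f a (suc n) = (if a ≤ᵇ n then f n else 1) * prodRange f a n

module Submission where

-- Work with 2^Φ, the product of the sizes s(y) of all nodes. rotate_up(u), with parent y,
-- grandparent z, a = sibling(u) and b = sibling(y), changes only the cluster of y, from size
-- s(y) to s(a) + s(b); so 2^Φ is multiplied by (s(a) + s(b)) / s(y). Along the ancestor chain
-- p_0(x), p_1(x), ... (the root repeated beyond the depth) a rotation of an ancestor of x removes
-- y and keeps the sizes of all other chain nodes, and the new y is the sibling of the chain node
-- just below the returned node z. Hence the product over [a, b] before the step equals s(y) times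
-- the product over [a, b) after it, and s(y) cancels against the change of 2^Φ, leaving the factor
-- s(sibling(p_{ℓ-1}(x'))). In the zig-zag case the first rotation only changes the size of p on
-- the chain, which cancels in the same way, and the second removes g.

open import Defs
open import Data.Bool using (Bool; true; false; if_then_else_)
import Data.Bool as Bool
open import Data.Empty using (⊥; ⊥-elim)
open import Data.Fin using (Fin; zero; suc)
open import Data.List
  using (List; []; _∷_; _++_; _∷ʳ_; length; map; take; drop; lookup; _[_]∷=_; concatMap; initLast; _∷ʳ′_)
open import Data.List.Properties
  using ( ++-identityʳ; ++-assoc; length-++; map-++; length-map; take-[]; length-take; length-drop
        ; take++drop≡id; ∷-injective; ∷ʳ-injective; reverse-++; reverse-involutive )
open import Data.List.Membership.Propositional using (_∈_)
open import Data.List.Membership.Propositional.Properties using (∈-++⁺ˡ; ∈-++⁺ʳ)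
open import Data.List.Relation.Binary.Permutation.Propositional
  using (_↭_; ↭-refl; ↭-sym; ↭-trans; prep; ↭⇒↭ₛ; module PermutationReasoning)
open import Data.List.Relation.Binary.Permutation.Propositional.Properties using (++⁺; ++⁺ˡ; ++⁺ʳ; ++-comm; shift)
import Data.List.Relation.Unary.All as All
import Data.List.Relation.Unary.All.Properties as All
open import Data.List.Relation.Unary.AllPairs using ([]; _∷_)
open import Data.List.Relation.Unary.Any using (here; there)
open import Data.List.Relation.Unary.Unique.Propositional using (Unique)
open import Data.Maybe using (just; nothing; maybe)
import Data.Maybe as Maybe
open import Data.Nat
  using (ℕ; zero; suc; pred; _+_; _*_; _∸_; _≤_; _<_; _≤′_; ≤′-refl; ≤′-step; _≤ᵇ_; _≡ᵇ_; z≤n; s≤s; >-nonZero)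
open import Data.Nat.Properties
open import Data.Nat.Solver using (module +-*-Solver)
open import Data.Product using (Σ-syntax; _×_; _,_)
open import Data.Sum using (inj₁; inj₂)
open import Function using (_∘_; case_of_)
open import Relation.Binary.PropositionalEquality
open import Relation.Nullary using (yes; no)

open import Data.List.Relation.Binary.Permutation.Setoid.Properties (setoid ℕ) using (Unique-resp-↭)
open +-*-Solver using (solve; _:*_; _:=_)

module _ {A : Set} where

  Unique-++⁻ˡ : ∀ (xs : List A) {ys} → Unique (xs ++ ys) → Unique xs
  Unique-++⁻ˡ []       _        = []
  Unique-++⁻ˡ (x ∷ xs) (x∉ ∷ u) = All.++⁻ˡ xs x∉ ∷ Unique-++⁻ˡ xs u

  Unique-++⁻ʳ : ∀ (xs : List A) {ys} → Unique (xs ++ ys) → Unique ys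
  Unique-++⁻ʳ []       u       = u
  Unique-++⁻ʳ (x ∷ xs) (_ ∷ u) = Unique-++⁻ʳ xs u

  Unique-++-disjoint : ∀ (xs : List A) {ys z} → Unique (xs ++ ys) → z ∈ xs → z ∈ ys → ⊥
  Unique-++-disjoint (x ∷ xs) (x∉ ∷ u) (here refl) z∈ys = All.lookup x∉ (∈-++⁺ʳ xs z∈ys) refl
  Unique-++-disjoint (x ∷ xs) (_ ∷ u)  (there z∈)  z∈ys = Unique-++-disjoint xs u z∈ z∈ys

++-cancel-length : ∀ {A : Set} (xs ys : List A) {zs ws} → length xs ≡ length ys → xs ++ zs ≡ ys ++ ws → xs ≡ ys × zs ≡ ws
++-cancel-length []       []       _   eq = refl , eq
++-cancel-length (x ∷ xs) (y ∷ ys) len eq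
  with refl , eq′  ← ∷-injective eq
  with refl , refl ← ++-cancel-length xs ys (suc-injective len) eq′ = refl , refl

length-∷ʳ : ∀ {A : Set} (xs : List A) x → length (xs ∷ʳ x) ≡ suc (length xs)
length-∷ʳ xs x = trans (length-++ xs) (+-comm (length xs) 1)

take-pred-∷ʳ : ∀ {A : Set} m (xs : List A) {ys y} → m ≤ length xs → take m xs ≡ ys ∷ʳ y → take (pred m) xs ≡ ys
take-pred-∷ʳ zero          xs           {[]}        _        ()
take-pred-∷ʳ zero          xs           {_ ∷ _}     _        ()
take-pred-∷ʳ (suc zero)    (x ∷ xs)     {[]}        _        eq = refl
take-pred-∷ʳ (suc zero)    (x ∷ xs)     {_ ∷ []}    _        eq = case ∷-injective eq of λ where (_ , ())
take-pred-∷ʳ (suc zero)    (x ∷ xs)     {_ ∷ _ ∷ _} _        eq = case ∷-injective eq of λ where (_ , ())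
take-pred-∷ʳ (suc (suc m)) (x ∷ x′ ∷ _) {[]}        _        eq = case ∷-injective eq of λ where (_ , ())
take-pred-∷ʳ (suc (suc m)) (x ∷ xs)     {y ∷ ys}    (s≤s m≤) eq with ∷-injective eq
... | refl , eq′ = cong (x ∷_) (take-pred-∷ʳ (suc m) xs m≤ eq′)

-- Entry i of x ∷ xs, or its last entry when i is out of range: this is how p_i(x) becomes the root
-- once i exceeds the depth of x.
clampedLookup : {A : Set} → A → List A → ℕ → A
clampedLookup x xs       zero    = x
clampedLookup x []       (suc i) = x
clampedLookup x (y ∷ ys) (suc i) = clampedLookup y ys i

module _ {A : Set} where

  clampedLookup-[] : ∀ (x : A) i → clampedLookup x [] i ≡ x
  clampedLookup-[] x zero    = refl
  clampedLookup-[] x (suc i) = refl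

  clampedLookup-prefix : ∀ (x : A) ws ys zs {i} → i ≤ length ws →
    clampedLookup x (ws ++ ys) i ≡ clampedLookup x (ws ++ zs) i
  clampedLookup-prefix x ws       ys zs {zero}  _        = refl
  clampedLookup-prefix x (w ∷ ws) ys zs {suc i} (s≤s i≤) = clampedLookup-prefix w ws ys zs i≤

  clampedLookup-∷ʳ-≤ : ∀ (x : A) ws z {i} → i ≤ length ws → clampedLookup x (ws ∷ʳ z) i ≡ clampedLookup x ws i
  clampedLookup-∷ʳ-≤ x ws z {i} i≤ =
    trans (clampedLookup-prefix x ws (z ∷ []) [] i≤) (cong (λ l → clampedLookup x l i) (++-identityʳ ws))

  clampedLookup-∷ʳ-> : ∀ (x : A) ws z {i} → length ws < i → clampedLookup x (ws ∷ʳ z) i ≡ z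
  clampedLookup-∷ʳ-> x []       z {suc zero}    _        = refl
  clampedLookup-∷ʳ-> x []       z {suc (suc i)} _        = refl
  clampedLookup-∷ʳ-> x (w ∷ ws) z {suc i}       (s≤s <i) = clampedLookup-∷ʳ-> w ws z <i

  clampedLookup-++-∷ : ∀ (x : A) ws y ys i →
    clampedLookup x (ws ++ y ∷ ys) (i + suc (length ws)) ≡ clampedLookup y ys i
  clampedLookup-++-∷ x []       y ys i rewrite +-comm i 1 = refl
  clampedLookup-++-∷ x (w ∷ ws) y ys i rewrite +-suc i (suc (length ws)) = clampedLookup-++-∷ w ws y ys i

  clampedLookup-delete : ∀ (x : A) ws u v zs {i} → suc (length ws) ≤ i →
    clampedLookup x (ws ++ u ∷ v ∷ zs) (suc i) ≡ clampedLookup x (ws ++ v ∷ zs) i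
  clampedLookup-delete x []       u v zs {suc i} _         = refl
  clampedLookup-delete x (w ∷ ws) u v zs {suc i} (s≤s ≤i) = clampedLookup-delete w ws u v zs ≤i

  clampedLookup-update : ∀ (x : A) ws u w v zs {i} → i ≢ suc (length ws) →
    clampedLookup x (ws ++ u ∷ v ∷ zs) i ≡ clampedLookup x (ws ++ w ∷ v ∷ zs) i
  clampedLookup-update x ws       u w v zs {zero}        _  = refl
  clampedLookup-update x []       u w v zs {suc zero}    i≢ = ⊥-elim (i≢ refl)
  clampedLookup-update x []       u w v zs {suc (suc i)} _  = refl
  clampedLookup-update x (y ∷ ws) u w v zs {suc i}       i≢ =
    clampedLookup-update y ws u w v zs (λ i≡ → i≢ (cong suc i≡))

clampedLookup-map-++-∷ : ∀ {A B : Set} (f : A → B) x W e Z i →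
  clampedLookup x (map f (W ++ e ∷ Z)) (i + suc (length W)) ≡ clampedLookup (f e) (map f Z) i
clampedLookup-map-++-∷ f x W e Z i =
  trans (cong₂ (clampedLookup x) (map-++ f W (e ∷ Z)) (cong (λ n → i + suc n) (sym (length-map f W))))
        (clampedLookup-++-∷ x (map f W) (f e) (map f Z) i)

prodRange-suc : ∀ f {a n} → a ≤ n → prodRange f a (suc n) ≡ f n * prodRange f a n
prodRange-suc f {a} {n} a≤n with a ≤ᵇ n | ≤⇒≤ᵇ a≤n
... | true | _ = refl

prodRange-cong : ∀ {f g} a n → (∀ {i} → i < n → f i ≡ g i) → prodRange f a n ≡ prodRange g a n
prodRange-cong a zero    f≗g = refl
prodRange-cong a (suc n) f≗g =
  cong₂ (λ y z → (if a ≤ᵇ n then y else 1) * z) (f≗g ≤-refl) (prodRange-cong a n (f≗g ∘ m<n⇒m<1+n))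

module _ (f g : ℕ → ℕ) {a j : ℕ} (a≤j : a ≤ j) where
  open ≡-Reasoning

  prodRange-delete : (∀ {i} → i < j → f i ≡ g i) → (∀ {i} → j ≤ i → f (suc i) ≡ g i) →
    ∀ {n} → j ≤′ n → prodRange f a (suc n) ≡ f j * prodRange g a n
  prodRange-delete below above ≤′-refl =
    trans (prodRange-suc f a≤j) (cong (f j *_) (prodRange-cong a j below))
  prodRange-delete below above (≤′-step {n} j≤′n) = begin
    prodRange f a (suc (suc n))      ≡⟨ prodRange-suc f (≤-trans a≤j (≤′⇒≤ (≤′-step j≤′n))) ⟩
    f (suc n) * prodRange f a (suc n) ≡⟨ cong₂ _*_ (above (≤′⇒≤ j≤′n)) (prodRange-delete below above j≤′n) ⟩
    g n * (f j * prodRange g a n)     ≡⟨ solve 3 (λ x y z → x :* (y :* z) := y :* (x :* z)) refl (g n) (f j) _ ⟩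
    f j * (g n * prodRange g a n)     ≡⟨ cong (f j *_) (prodRange-suc g (≤-trans a≤j (≤′⇒≤ j≤′n))) ⟨
    f j * prodRange g a (suc n)       ∎

  prodRange-update : (∀ {i} → i ≢ j → f i ≡ g i) →
    ∀ {n} → suc j ≤′ n → prodRange f a n * g j ≡ prodRange g a n * f j
  prodRange-update elsewhere ≤′-refl = begin
    prodRange f a (suc j) * g j   ≡⟨ cong (_* g j) (prodRange-suc f a≤j) ⟩
    f j * prodRange f a j * g j   ≡⟨ cong (λ p → f j * p * g j) (prodRange-cong a j (λ i<j → elsewhere (<⇒≢ i<j))) ⟩
    f j * prodRange g a j * g j   ≡⟨ solve 3 (λ u p v → u :* p :* v := v :* p :* u) refl (f j) (prodRange g a j) (g j) ⟩
    g j * prodRange g a j * f j   ≡⟨ cong (_* f j) (prodRange-suc g a≤j) ⟨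
    prodRange g a (suc j) * f j   ∎
  prodRange-update elsewhere (≤′-step {n} j<′n) = begin
    prodRange f a (suc n) * g j   ≡⟨ cong (_* g j) (prodRange-suc f a≤n) ⟩
    f n * prodRange f a n * g j   ≡⟨ *-assoc (f n) _ _ ⟩
    f n * (prodRange f a n * g j) ≡⟨ cong₂ _*_ (elsewhere (>⇒≢ j<n)) (prodRange-update elsewhere j<′n) ⟩
    g n * (prodRange g a n * f j) ≡⟨ *-assoc (g n) _ _ ⟨
    g n * prodRange g a n * f j   ≡⟨ cong (_* f j) (prodRange-suc g a≤n) ⟨
    prodRange g a (suc n) * f j   ∎
    where
    j<n : j < n
    j<n = ≤′⇒≤ j<′n
    a≤n : a ≤ n
    a≤n = ≤-trans a≤j (<⇒≤ j<n)

module _ (x : ℕ) (ws : List ℕ) (u v : ℕ) (zs : List ℕ) {a : ℕ} (a≤ : a ≤ suc (length ws)) where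

  prodRange-clampedLookup-delete : ∀ {b} → suc (length ws) ≤ b →
    prodRange (clampedLookup x (ws ++ u ∷ v ∷ zs)) a (suc b) ≡ u * prodRange (clampedLookup x (ws ++ v ∷ zs)) a b
  prodRange-clampedLookup-delete ≤b =
    trans (prodRange-delete _ _ a≤ (λ i< → clampedLookup-prefix x ws _ _ (≤-pred i<))
                                   (clampedLookup-delete x ws u v zs) (≤⇒≤′ ≤b))
          (cong (_* _) (clampedLookup-++-∷ x ws u (v ∷ zs) 0))

  prodRange-clampedLookup-update : ∀ w {n} → suc (length ws) < n →
    prodRange (clampedLookup x (ws ++ u ∷ v ∷ zs)) a n * w ≡ prodRange (clampedLookup x (ws ++ w ∷ v ∷ zs)) a n * u
  prodRange-clampedLookup-update w {n} <n =
    subst₂ (λ p q → prodRange (clampedLookup x (ws ++ u ∷ v ∷ zs)) a n * p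
                  ≡ prodRange (clampedLookup x (ws ++ w ∷ v ∷ zs)) a n * q)
      (clampedLookup-++-∷ x ws w (v ∷ zs) 0) (clampedLookup-++-∷ x ws u (v ∷ zs) 0)
      (prodRange-update _ _ a≤ (clampedLookup-update x ws u w v zs) (≤⇒≤′ <n))

module _ (pT pT′ x : ℕ) (ws : List ℕ) (u v : ℕ) (zs : List ℕ) (σ : ℕ) {a b : ℕ} where
  open ≡-Reasoning

  potential-single : pT′ * u ≡ pT * σ → a ≤ suc (length ws) → suc (length ws) ≤ b →
    pT′ * prodRange (clampedLookup x (ws ++ u ∷ v ∷ zs)) a (suc b) ≡ pT * σ * prodRange (clampedLookup x (ws ++ v ∷ zs)) a b
  potential-single pot a≤ ≤b = begin
    pT′ * prodRange (clampedLookup x (ws ++ u ∷ v ∷ zs)) a (suc b) ≡⟨ cong (pT′ *_) (prodRange-clampedLookup-delete x ws u v zs a≤ ≤b) ⟩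
    pT′ * (u * prodRange (clampedLookup x (ws ++ v ∷ zs)) a b)     ≡⟨ *-assoc pT′ u _ ⟨
    pT′ * u * prodRange (clampedLookup x (ws ++ v ∷ zs)) a b       ≡⟨ cong (_* prodRange (clampedLookup x (ws ++ v ∷ zs)) a b) pot ⟩
    pT * σ * prodRange (clampedLookup x (ws ++ v ∷ zs)) a b        ∎

  -- The first rotation changes the size of p_{|ws|+1} from u to w, the second removes p_{|ws|+2} (of size v).
  potential-double : ∀ y w → pT′ * v * u ≡ pT * w * σ → 0 < w → a ≤ suc (length ws) → suc (suc (length ws)) ≤ b →
    pT′ * prodRange (clampedLookup x (ws ++ u ∷ v ∷ y ∷ zs)) a (suc b) ≡ pT * σ * prodRange (clampedLookup x (ws ++ w ∷ y ∷ zs)) a b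
  potential-double y w pot w>0 a≤ ≤b = *-cancelʳ-≡ _ _ w {{>-nonZero w>0}} (begin
    pT′ * Old * w          ≡⟨ *-assoc pT′ Old w ⟩
    pT′ * (Old * w)        ≡⟨ cong (pT′ *_) (prodRange-clampedLookup-update x ws u v (y ∷ zs) a≤ w (s≤s (≤-trans (n≤1+n _) ≤b))) ⟩
    pT′ * (Mid * u)        ≡⟨ cong (λ p → pT′ * (p * u)) delete ⟩
    pT′ * (v * New * u)    ≡⟨ solve 4 (λ p v n u → p :* (v :* n :* u) := p :* v :* u :* n) refl pT′ v New u ⟩
    pT′ * v * u * New      ≡⟨ cong (_* New) pot ⟩
    pT * w * σ * New       ≡⟨ solve 4 (λ p w s n → p :* w :* s :* n := p :* s :* n :* w) refl pT w σ New ⟩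
    pT * σ * New * w       ∎)
    where
    Old Mid New : ℕ
    Old = prodRange (clampedLookup x (ws ++ u ∷ v ∷ y ∷ zs)) a (suc b)
    Mid = prodRange (clampedLookup x (ws ++ w ∷ v ∷ y ∷ zs)) a (suc b)
    New = prodRange (clampedLookup x (ws ++ w ∷ y ∷ zs)) a b
    delete : Mid ≡ v * New
    delete = subst₂ (λ l l′ → prodRange (clampedLookup x l) a (suc b) ≡ v * prodRange (clampedLookup x l′) a b)
      (++-assoc ws (w ∷ []) (v ∷ y ∷ zs)) (++-assoc ws (w ∷ []) (y ∷ zs))
      (prodRange-clampedLookup-delete x (ws ∷ʳ w) v y zs (subst (a ≤_) (cong suc (sym (length-∷ʳ ws w))) (≤-trans a≤ (n≤1+n _)))
        (subst (λ n → suc n ≤ b) (sym (length-∷ʳ ws w)) ≤b))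

subAt-node : ∀ i l r d p → subAt (node i l r) (d ∷ p) ≡ subAt (pick d l r) p
subAt-node i l r L p = refl
subAt-node i l r R p = refl

subAt-++ : ∀ T p {S} s → subAt T p ≡ just S → subAt T (p ++ s) ≡ subAt S s
subAt-++ T            []      s refl = refl
subAt-++ (node i l r) (L ∷ p) s eq   = subAt-++ l p s eq
subAt-++ (node i l r) (R ∷ p) s eq   = subAt-++ r p s eq

subAt⇒idAt : ∀ T p {S} → subAt T p ≡ just S → idAt T p ≡ just (idOf S)
subAt⇒idAt T p = cong (Maybe.map idOf)

idAt-subAt : ∀ T p {y} → idAt T p ≡ just y → Σ[ S ∈ Tree ] subAt T p ≡ just S × idOf S ≡ y
idAt-subAt T p eq with subAt T p
idAt-subAt T p refl | just S = S , refl , refl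

size-node : ∀ i l r → size (node i l r) ≡ size l + size r
size-node i l r = length-++ (edges l)

size-pick : ∀ i l r d → size (node i l r) ≡ size (pick d l r) + size (pick (flip d) l r)
size-pick i l r L = size-node i l r
size-pick i l r R = trans (size-node i l r) (+-comm (size l) (size r))

size>0 : ∀ T → 0 < size T
size>0 (leaf _ _ _)  = s≤s z≤n
size>0 (node i l r) = subst (0 <_) (sym (size-node i l r)) (<-≤-trans (size>0 l) (m≤m+n _ _))

prodNodes>0 : ∀ T → 0 < prodNodes T
prodNodes>0 (leaf _ _ _)  = s≤s z≤n
prodNodes>0 (node i l r) = m*n>0 (m*n>0 (size>0 (node i l r)) (prodNodes>0 l)) (prodNodes>0 r)
  where
  m*n>0 : ∀ {m n} → 0 < m → 0 < n → 0 < m * n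
  m*n>0 {suc m} {suc n} _ _ = s≤s z≤n

flip-involutive : ∀ d → flip (flip d) ≡ d
flip-involutive L = refl
flip-involutive R = refl

ids-pick : ∀ i l r d → ids (node i l r) ↭ i ∷ ids (pick d l r) ++ ids (pick (flip d) l r)
ids-pick i l r L = ↭-refl
ids-pick i l r R = prep i (++-comm (ids l) (ids r))

prodNodes-pick : ∀ i l r d → prodNodes (node i l r) ≡ size (node i l r) * prodNodes (pick d l r) * prodNodes (pick (flip d) l r)
prodNodes-pick i l r L = refl
prodNodes-pick i l r R = solve 3 (λ s p q → s :* p :* q := s :* q :* p) refl (size (node i l r)) (prodNodes l) (prodNodes r)

anc-[] : ∀ i → anc i [] ≡ []
anc-[] i = take-[] (0 ∸ i)

length-anc : ∀ i p → length (anc i p) ≡ length p ∸ i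
length-anc i p = trans (length-take (length p ∸ i) p) (m≤n⇒m⊓n≡m (m∸n≤m (length p) i))

anc-∷-≤ : ∀ {i} d p → i ≤ length p → anc i (d ∷ p) ≡ d ∷ anc i p
anc-∷-≤ d p i≤ = cong (λ m → take m (d ∷ p)) (+-∸-assoc 1 i≤)

anc-∷-> : ∀ {i} d p → length p < i → anc i (d ∷ p) ≡ []
anc-∷-> d p <i = cong (λ m → take m (d ∷ p)) (m≤n⇒m∸n≡0 <i)

anc-∷ʳ : ∀ k q {P d} → anc k q ≡ P ∷ʳ d → anc (suc k) q ≡ P
anc-∷ʳ k q eq = trans (cong (λ m → take m q) (sym (pred[m∸n]≡m∸[1+n] (length q) k))) (take-pred-∷ʳ _ q (m∸n≤m (length q) k) eq)

anc-<⇒≢[] : ∀ {j} p → j < length p → anc j p ≢ []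
anc-<⇒≢[] {j} p j< anc≡[] = <⇒≢ (m<n⇒0<n∸m j<) (sym (trans (sym (length-anc j p)) (cong length anc≡[])))

anc-++-∷⇒< : ∀ k q P {d P′} → anc k q ≡ P ++ d ∷ P′ → k < length q
anc-++-∷⇒< k q P eq = m∸n≢0⇒n<m λ ≡0 →
  m+1+n≢0 (length P) (trans (sym (trans (cong length eq) (length-++ P))) (trans (length-anc k q) ≡0))

anc-++ : ∀ k q P s → anc k q ≡ P ++ s → anc (length s + k) q ≡ P
anc-++ k q P []      eq = trans eq (++-identityʳ P)
anc-++ k q P (e ∷ s) eq = anc-∷ʳ (length s + k) q (anc-++ k q (P ∷ʳ e) s (trans eq (sym (++-assoc P (e ∷ []) s))))

anc-split : ∀ m q → m ≤ length q → Σ[ t ∈ List Dir ] anc m q ++ t ≡ q × length t ≡ m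
anc-split m q m≤ = drop (length q ∸ m) q , take++drop≡id (length q ∸ m) q , trans (length-drop (length q ∸ m) q) (m∸[m∸n]≡n m≤)

anc-injective : ∀ {i j} q → i ≤ length q → j ≤ length q → anc i q ≡ anc j q → i ≡ j
anc-injective {i} {j} q i≤ j≤ eq = ∸-cancelˡ-≡ i≤ j≤ (trans (sym (length-anc i q)) (trans (cong length eq) (length-anc j q)))

record Ancestor : Set where
  constructor ancestor
  field
    ancSize ancId offPathSize : ℕ
open Ancestor

ancestorEntry : ℕ → Tree → Tree → Dir → Ancestor
ancestorEntry i l r d = ancestor (size (node i l r)) i (size (pick (flip d) l r))

-- The proper ancestors of the node at a path, parent first; offPathSize is the size of the child off the path.
ancestors : Tree → List Dir → List Ancestor
ancestors T            []      = []
ancestors (leaf _ _ _) (_ ∷ _) = []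
ancestors (node i l r) (d ∷ p) = ancestors (pick d l r) p ∷ʳ ancestorEntry i l r d

ancestors-++ : ∀ T p {S} s → subAt T p ≡ just S → ancestors T (p ++ s) ≡ ancestors S s ++ ancestors T p
ancestors-++ T            []      s refl = sym (++-identityʳ _)
ancestors-++ (node i l r) (L ∷ p) s eq rewrite ancestors-++ l p s eq = ++-assoc (ancestors _ s) _ _
ancestors-++ (node i l r) (R ∷ p) s eq rewrite ancestors-++ r p s eq = ++-assoc (ancestors _ s) _ _

length-ancestors : ∀ T p {S} → subAt T p ≡ just S → length (ancestors T p) ≡ length p
length-ancestors T            []      refl = refl
length-ancestors (node i l r) (L ∷ p) eq rewrite length-++ (ancestors l p) {ancestorEntry i l r L ∷ []} | length-ancestors l p eq = +-comm _ 1
length-ancestors (node i l r) (R ∷ p) eq rewrite length-++ (ancestors r p) {ancestorEntry i l r R ∷ []} | length-ancestors r p eq = +-comm _ 1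

module _ {B : Set} (f : Tree → B) (g : Ancestor → B) (g-entry : ∀ i l r d → g (ancestorEntry i l r d) ≡ f (node i l r)) where
  open ≡-Reasoning

  subAt-anc : ∀ T p {S} k → subAt T p ≡ just S →
    Maybe.map f (subAt T (anc k p)) ≡ just (clampedLookup (f S) (map g (ancestors T p)) k)
  subAt-anc T            []      k refl rewrite anc-[] k = cong just (sym (clampedLookup-[] (f T) k))
  subAt-anc (node i l r) (d ∷ p) {S} k eq with k ≤? length p
  ... | yes k≤ = begin
    Maybe.map f (subAt (node i l r) (anc k (d ∷ p)))     ≡⟨ cong (λ p′ → Maybe.map f (subAt (node i l r) p′)) (anc-∷-≤ d p k≤) ⟩
    Maybe.map f (subAt (node i l r) (d ∷ anc k p))       ≡⟨ cong (Maybe.map f) (subAt-node i l r d (anc k p)) ⟩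
    Maybe.map f (subAt (pick d l r) (anc k p))           ≡⟨ subAt-anc (pick d l r) p k (trans (sym (subAt-node i l r d p)) eq) ⟩
    just (clampedLookup (f S) (map g As) k)               ≡⟨ cong just (clampedLookup-∷ʳ-≤ (f S) (map g As) _ k≤′) ⟨
    just (clampedLookup (f S) (map g As ∷ʳ g e) k)        ≡⟨ cong (λ xs → just (clampedLookup (f S) xs k)) (map-++ g As (e ∷ [])) ⟨
    just (clampedLookup (f S) (map g (As ∷ʳ e)) k)        ∎
    where
    As : List Ancestor
    As = ancestors (pick d l r) p
    e : Ancestor
    e = ancestorEntry i l r d
    k≤′ : k ≤ length (map g As)
    k≤′ = subst (k ≤_) (sym (trans (length-map g As) (length-ancestors _ p (trans (sym (subAt-node i l r d p)) eq)))) k≤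
  ... | no k≰ = begin
    Maybe.map f (subAt (node i l r) (anc k (d ∷ p)))     ≡⟨ cong (λ p′ → Maybe.map f (subAt (node i l r) p′)) (anc-∷-> d p (≰⇒> k≰)) ⟩
    just (f (node i l r))                                ≡⟨ cong just (g-entry i l r d) ⟨
    just (g e)                                           ≡⟨ cong just (clampedLookup-∷ʳ-> (f S) (map g As) _ <k) ⟨
    just (clampedLookup (f S) (map g As ∷ʳ g e) k)        ≡⟨ cong (λ xs → just (clampedLookup (f S) xs k)) (map-++ g As (e ∷ [])) ⟨
    just (clampedLookup (f S) (map g (As ∷ʳ e)) k)        ∎
    where
    As : List Ancestor
    As = ancestors (pick d l r) p
    e : Ancestor
    e = ancestorEntry i l r d
    <k : length (map g As) < k
    <k = subst (_< k) (sym (trans (length-map g As) (length-ancestors _ p (trans (sym (subAt-node i l r d p)) eq)))) (≰⇒> k≰)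

szAt-anc : ∀ T p {S} k → subAt T p ≡ just S → szAt T (anc k p) ≡ clampedLookup (size S) (map ancSize (ancestors T p)) k
szAt-anc T p k eq = size-of (subAt T (anc k p)) (subAt-anc size ancSize (λ _ _ _ _ → refl) T p k eq)
  where
  size-of : ∀ m {n} → Maybe.map size m ≡ just n → maybe size 0 m ≡ n
  size-of (just _) refl = refl

idAt-anc : ∀ T p {S} k → subAt T p ≡ just S → idAt T (anc k p) ≡ just (clampedLookup (idOf S) (map ancId (ancestors T p)) k)
idAt-anc = subAt-anc idOf ancId (λ _ _ _ _ → refl)

szSib-∷ʳ : ∀ T P e → szSib T (P ∷ʳ e) ≡ szAt T (P ∷ʳ flip e)
szSib-∷ʳ T P e rewrite reverse-++ P (e ∷ []) | reverse-involutive P = refl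

szSib-node : ∀ i l r d P → P ≢ [] → szSib (node i l r) (d ∷ P) ≡ szSib (pick d l r) P
szSib-node i l r d P P≢[] with initLast P
... | []        = ⊥-elim (P≢[] refl)
... | P′ ∷ʳ′ e  = begin
  szSib (node i l r) (d ∷ P′ ∷ʳ e)     ≡⟨ szSib-∷ʳ (node i l r) (d ∷ P′) e ⟩
  szAt (node i l r) (d ∷ P′ ∷ʳ flip e) ≡⟨ cong (maybe size 0) (subAt-node i l r d (P′ ∷ʳ flip e)) ⟩
  szAt (pick d l r) (P′ ∷ʳ flip e)     ≡⟨ szSib-∷ʳ (pick d l r) P′ e ⟨
  szSib (pick d l r) (P′ ∷ʳ e)         ∎
  where open ≡-Reasoning

szSib-anc : ∀ T p {S} {j} → subAt T p ≡ just S → j < length p →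
  szSib T (anc j p) ≡ clampedLookup 0 (map offPathSize (ancestors T p)) (suc j)
szSib-anc (node i l r) (d ∷ p) {S} {j} eq j<
  rewrite map-++ offPathSize (ancestors (pick d l r) p) (ancestorEntry i l r d ∷ [])
  with m≤n⇒m<n∨m≡n (≤-pred j<)
... | inj₁ j<p = begin
  szSib (node i l r) (anc j (d ∷ p))  ≡⟨ cong (szSib (node i l r)) (anc-∷-≤ d p (<⇒≤ j<p)) ⟩
  szSib (node i l r) (d ∷ anc j p)    ≡⟨ szSib-node i l r d (anc j p) (anc-<⇒≢[] p j<p) ⟩
  szSib (pick d l r) (anc j p)        ≡⟨ szSib-anc (pick d l r) p eq′ j<p ⟩
  clampedLookup 0 (map offPathSize As) (suc j)               ≡⟨ clampedLookup-∷ʳ-≤ 0 (map offPathSize As) _ (subst (suc j ≤_) (sym |As|) j<p) ⟨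
  clampedLookup 0 (map offPathSize As ∷ʳ offPathSize e) (suc j) ∎
  where
  open ≡-Reasoning
  As : List Ancestor
  As = ancestors (pick d l r) p
  e : Ancestor
  e = ancestorEntry i l r d
  eq′ : subAt (pick d l r) p ≡ just S
  eq′ = trans (sym (subAt-node i l r d p)) eq
  |As| : length (map offPathSize As) ≡ length p
  |As| = trans (length-map offPathSize As) (length-ancestors _ p eq′)
... | inj₂ refl = begin
  szSib (node i l r) (anc j (d ∷ p))  ≡⟨ cong (szSib (node i l r)) (anc-∷-≤ d p ≤-refl) ⟩
  szSib (node i l r) (d ∷ anc j p)    ≡⟨ cong (λ P → szSib (node i l r) (d ∷ P)) anc-self ⟩
  szSib (node i l r) ([] ∷ʳ d)        ≡⟨ szSib-∷ʳ (node i l r) [] d ⟩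
  szAt (node i l r) (flip d ∷ [])     ≡⟨ cong (maybe size 0) (subAt-node i l r (flip d) []) ⟩
  offPathSize e                       ≡⟨ clampedLookup-∷ʳ-> 0 (map offPathSize As) _ (subst (_< suc j) (sym |As|) ≤-refl) ⟨
  clampedLookup 0 (map offPathSize As ∷ʳ offPathSize e) (suc j) ∎
  where
  open ≡-Reasoning
  As : List Ancestor
  As = ancestors (pick d l r) p
  e : Ancestor
  e = ancestorEntry i l r d
  |As| : length (map offPathSize As) ≡ length p
  |As| = trans (length-map offPathSize As) (length-ancestors _ p (trans (sym (subAt-node i l r d p)) eq))
  anc-self : anc (length p) p ≡ []
  anc-self = cong (λ m → take m p) (n∸n≡0 (length p))

record Profile (T : Tree) (q : List Dir) (X : Tree) (as : List Ancestor) : Set where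
  field
    length-path     : length q ≡ length as
    size-at         : ∀ i → szAt T (anc i q) ≡ clampedLookup (size X) (map ancSize as) i
    id-at           : ∀ i → idAt T (anc i q) ≡ just (clampedLookup (idOf X) (map ancId as) i)
    sibling-size-at : ∀ {j} → j < length q → szSib T (anc j q) ≡ clampedLookup 0 (map offPathSize as) (suc j)

profile : ∀ {T q X} → subAt T q ≡ just X → Profile T q X (ancestors T q)
profile {T} {q} sX = record
  { length-path     = sym (length-ancestors T q sX)
  ; size-at         = λ i → szAt-anc T q i sX
  ; id-at           = λ i → idAt-anc T q i sX
  ; sibling-size-at = szSib-anc T q sX
  }

profile-ancId : ∀ {T q X W e Z} → Profile T q X (W ++ e ∷ Z) → ∀ i →
  idAt T (anc (i + suc (length W)) q) ≡ just (clampedLookup (ancId e) (map ancId Z) i)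
profile-ancId {X = X} {W} {e} {Z} P i = trans (Profile.id-at P (i + suc (length W))) (cong just (clampedLookup-map-++-∷ ancId (idOf X) W e Z i))

idAt-∈-ids : ∀ T p {y} → idAt T p ≡ just y → y ∈ ids T
idAt-∈-ids (leaf i u v) []      refl = here refl
idAt-∈-ids (node i l r) []      refl = here refl
idAt-∈-ids (node i l r) (L ∷ p) eq   = there (∈-++⁺ˡ (idAt-∈-ids l p eq))
idAt-∈-ids (node i l r) (R ∷ p) eq   = there (∈-++⁺ʳ (ids l) (idAt-∈-ids r p eq))

idAt-injective : ∀ T → Unique (ids T) → ∀ p₁ p₂ {y} → idAt T p₁ ≡ just y → idAt T p₂ ≡ just y → p₁ ≡ p₂
idAt-injective T            _        []       []       _    _    = refl
idAt-injective (node i l r) (i∉ ∷ _) []       (L ∷ p₂) refl eq₂ = ⊥-elim (All.lookup i∉ (∈-++⁺ˡ (idAt-∈-ids l p₂ eq₂)) refl)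
idAt-injective (node i l r) (i∉ ∷ _) []       (R ∷ p₂) refl eq₂ = ⊥-elim (All.lookup i∉ (∈-++⁺ʳ (ids l) (idAt-∈-ids r p₂ eq₂)) refl)
idAt-injective (node i l r) (i∉ ∷ _) (L ∷ p₁) []       eq₁ refl = ⊥-elim (All.lookup i∉ (∈-++⁺ˡ (idAt-∈-ids l p₁ eq₁)) refl)
idAt-injective (node i l r) (i∉ ∷ _) (R ∷ p₁) []       eq₁ refl = ⊥-elim (All.lookup i∉ (∈-++⁺ʳ (ids l) (idAt-∈-ids r p₁ eq₁)) refl)
idAt-injective (node i l r) (_ ∷ u)  (L ∷ p₁) (L ∷ p₂) eq₁ eq₂  = cong (L ∷_) (idAt-injective l (Unique-++⁻ˡ (ids l) u) p₁ p₂ eq₁ eq₂)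
idAt-injective (node i l r) (_ ∷ u)  (R ∷ p₁) (R ∷ p₂) eq₁ eq₂  = cong (R ∷_) (idAt-injective r (Unique-++⁻ʳ (ids l) u) p₁ p₂ eq₁ eq₂)
idAt-injective (node i l r) (_ ∷ u)  (L ∷ p₁) (R ∷ p₂) eq₁ eq₂  = ⊥-elim (Unique-++-disjoint (ids l) u (idAt-∈-ids l p₁ eq₁) (idAt-∈-ids r p₂ eq₂))
idAt-injective (node i l r) (_ ∷ u)  (R ∷ p₁) (L ∷ p₂) eq₁ eq₂  = ⊥-elim (Unique-++-disjoint (ids l) u (idAt-∈-ids l p₂ eq₂) (idAt-∈-ids r p₁ eq₁))

pathTo-idAt : ∀ x T {p} → pathTo x T ≡ just p → idAt T p ≡ just x
pathTo-idAt x (leaf i u v) eq with x ≡ᵇ i in x≡ᵇi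
pathTo-idAt x (leaf i u v) refl | true = cong just (sym (≡ᵇ⇒≡ x i (subst Bool.T (sym x≡ᵇi) _)))
pathTo-idAt x (node i l r) eq with x ≡ᵇ i in x≡ᵇi
pathTo-idAt x (node i l r) refl | true = cong just (sym (≡ᵇ⇒≡ x i (subst Bool.T (sym x≡ᵇi) _)))
... | false with pathTo x l in inl
pathTo-idAt x (node i l r) refl | false | just _ = pathTo-idAt x l inl
... | nothing with pathTo x r in inr
pathTo-idAt x (node i l r) refl | false | nothing | just _ = pathTo-idAt x r inr

pathTo-unique : ∀ {x T p} p′ → Unique (ids T) → pathTo x T ≡ just p → idAt T p′ ≡ just x → p ≡ p′
pathTo-unique {x} {T} {p} p′ u eq eq′ = idAt-injective T u p p′ (pathTo-idAt x T eq) eq′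

≅-sym : ∀ {A B} → A ≅ B → B ≅ A
≅-sym leafSame       = leafSame
≅-sym leafFlip       = leafFlip
≅-sym (nodeSame a b) = nodeSame (≅-sym a) (≅-sym b)
≅-sym (nodeSwap a b) = nodeSwap (≅-sym b) (≅-sym a)

≅-idOf : ∀ {A B} → A ≅ B → idOf A ≡ idOf B
≅-idOf leafSame       = refl
≅-idOf leafFlip       = refl
≅-idOf (nodeSame _ _) = refl
≅-idOf (nodeSwap _ _) = refl

≅-size : ∀ {A B} → A ≅ B → size A ≡ size B
≅-size leafSame = refl
≅-size leafFlip = refl
≅-size (nodeSame {i} {A} {A′} {B} {B′} a b) rewrite size-node i A B | size-node i A′ B′ = cong₂ _+_ (≅-size a) (≅-size b)
≅-size (nodeSwap {i} {A} {A′} {B} {B′} a b) rewrite size-node i A B | size-node i B′ A′ | ≅-size a | ≅-size b =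
  +-comm (size A′) (size B′)

≅-prodNodes : ∀ {A B} → A ≅ B → prodNodes A ≡ prodNodes B
≅-prodNodes leafSame = refl
≅-prodNodes leafFlip = refl
≅-prodNodes A≅B@(nodeSame a b) rewrite ≅-size A≅B | ≅-prodNodes a | ≅-prodNodes b = refl
≅-prodNodes A≅B@(nodeSwap {i} {A' = A′} {B' = B′} a b) rewrite ≅-size A≅B | ≅-prodNodes a | ≅-prodNodes b =
  solve 3 (λ s p q → s :* p :* q := s :* q :* p) refl (size (node i B′ A′)) (prodNodes A′) (prodNodes B′)

≅-ids : ∀ {A B} → A ≅ B → ids A ↭ ids B
≅-ids leafSame = ↭-refl
≅-ids leafFlip = ↭-refl
≅-ids (nodeSame {i} a b) = prep i (++⁺ (≅-ids a) (≅-ids b))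
≅-ids (nodeSwap {i} {A' = A′} {B' = B′} a b) = prep i (↭-trans (++⁺ (≅-ids a) (≅-ids b)) (++-comm (ids A′) (ids B′)))

≅-subAt : ∀ {A B} → A ≅ B → ∀ p {S} → subAt A p ≡ just S →
  Σ[ p′ ∈ List Dir ] Σ[ S′ ∈ Tree ] subAt B p′ ≡ just S′ × S ≅ S′ × ancestors A p ≡ ancestors B p′
≅-subAt A≅B            []      refl = [] , _ , refl , A≅B , refl
≅-subAt A≅B@(nodeSame {i} a b) (L ∷ p) eq with ≅-subAt a p eq
... | p′ , S′ , eq′ , S≅S′ , as≡ = L ∷ p′ , S′ , eq′ , S≅S′ , cong₂ _∷ʳ_ as≡ (cong₂ (λ s t → ancestor s i t) (≅-size A≅B) (≅-size b))
≅-subAt A≅B@(nodeSame {i} a b) (R ∷ p) eq with ≅-subAt b p eq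
... | p′ , S′ , eq′ , S≅S′ , as≡ = R ∷ p′ , S′ , eq′ , S≅S′ , cong₂ _∷ʳ_ as≡ (cong₂ (λ s t → ancestor s i t) (≅-size A≅B) (≅-size a))
≅-subAt A≅B@(nodeSwap {i} a b) (L ∷ p) eq with ≅-subAt a p eq
... | p′ , S′ , eq′ , S≅S′ , as≡ = R ∷ p′ , S′ , eq′ , S≅S′ , cong₂ _∷ʳ_ as≡ (cong₂ (λ s t → ancestor s i t) (≅-size A≅B) (≅-size b))
≅-subAt A≅B@(nodeSwap {i} a b) (R ∷ p) eq with ≅-subAt b p eq
... | p′ , S′ , eq′ , S≅S′ , as≡ = L ∷ p′ , S′ , eq′ , S≅S′ , cong₂ _∷ʳ_ as≡ (cong₂ (λ s t → ancestor s i t) (≅-size A≅B) (≅-size a))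

module _ {N O : Tree} (sizeN≡sizeO : size N ≡ size O) where

  size-replaceAt : ∀ T c → subAt T c ≡ just O → size (replaceAt T c N) ≡ size T
  size-replaceAt T            []      refl = sizeN≡sizeO
  size-replaceAt (node i l r) (L ∷ c) eq   rewrite size-node i (replaceAt l c N) r | size-node i l r | size-replaceAt l c eq = refl
  size-replaceAt (node i l r) (R ∷ c) eq   rewrite size-node i l (replaceAt r c N) | size-node i l r | size-replaceAt r c eq = refl

  ancestors-replaceAt : ∀ T c s → subAt T c ≡ just O → ancestors (replaceAt T c N) (c ++ s) ≡ ancestors N s ++ ancestors T c
  ancestors-replaceAt T            []      s refl = sym (++-identityʳ _)
  ancestors-replaceAt (node i l r) (L ∷ c) s eq
    rewrite ancestors-replaceAt l c s eq | size-replaceAt (node i l r) (L ∷ c) eq = ++-assoc (ancestors N s) _ _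
  ancestors-replaceAt (node i l r) (R ∷ c) s eq
    rewrite ancestors-replaceAt r c s eq | size-replaceAt (node i l r) (R ∷ c) eq = ++-assoc (ancestors N s) _ _

  prodNodes-replaceAt : ∀ T c → subAt T c ≡ just O → prodNodes (replaceAt T c N) * prodNodes O ≡ prodNodes T * prodNodes N
  prodNodes-replaceAt T            []      refl = *-comm (prodNodes N) (prodNodes T)
  prodNodes-replaceAt (node i l r) (L ∷ c) eq rewrite size-replaceAt (node i l r) (L ∷ c) eq =
    let s = size (node i l r) in begin
    s * prodNodes (replaceAt l c N) * prodNodes r * prodNodes O   ≡⟨ solve 4 (λ s x y z → s :* x :* y :* z := s :* (x :* z) :* y) refl s _ _ _ ⟩
    s * (prodNodes (replaceAt l c N) * prodNodes O) * prodNodes r ≡⟨ cong (λ x → s * x * prodNodes r) (prodNodes-replaceAt l c eq) ⟩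
    s * (prodNodes l * prodNodes N) * prodNodes r                 ≡⟨ solve 4 (λ s x y z → s :* (x :* z) :* y := s :* x :* y :* z) refl s _ _ _ ⟩
    s * prodNodes l * prodNodes r * prodNodes N                   ∎
    where open ≡-Reasoning
  prodNodes-replaceAt (node i l r) (R ∷ c) eq rewrite size-replaceAt (node i l r) (R ∷ c) eq =
    let s = size (node i l r) in begin
    s * prodNodes l * prodNodes (replaceAt r c N) * prodNodes O   ≡⟨ *-assoc (s * prodNodes l) _ _ ⟩
    s * prodNodes l * (prodNodes (replaceAt r c N) * prodNodes O) ≡⟨ cong (s * prodNodes l *_) (prodNodes-replaceAt r c eq) ⟩
    s * prodNodes l * (prodNodes r * prodNodes N)                 ≡⟨ *-assoc (s * prodNodes l) _ _ ⟨
    s * prodNodes l * prodNodes r * prodNodes N                   ∎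
    where open ≡-Reasoning

subAt-replaceAt : ∀ T c {N O} s → subAt T c ≡ just O → subAt (replaceAt T c N) (c ++ s) ≡ subAt N s
subAt-replaceAt T            []      s refl = refl
subAt-replaceAt (node i l r) (L ∷ c) s eq   = subAt-replaceAt l c s eq
subAt-replaceAt (node i l r) (R ∷ c) s eq   = subAt-replaceAt r c s eq

ids-replaceAt : ∀ T c {N O} → subAt T c ≡ just O → ids N ↭ ids O → ids (replaceAt T c N) ↭ ids T
ids-replaceAt T            []      refl N↭O = N↭O
ids-replaceAt (node i l r) (L ∷ c) eq   N↭O = prep i (++⁺ʳ (ids r) (ids-replaceAt l c eq N↭O))
ids-replaceAt (node i l r) (R ∷ c) eq   N↭O = prep i (++⁺ˡ (ids l) (ids-replaceAt r c eq N↭O))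

record Tracked (T X : Tree) (as : List Ancestor) : Set where
  constructor tracked
  field
    path           : List Dir
    subtree        : Tree
    subAt-path     : subAt T path ≡ just subtree
    size-subtree   : size subtree ≡ size X
    idOf-subtree   : idOf subtree ≡ idOf X
    ancestors-path : ancestors T path ≡ as

tracked-≅ : ∀ {T R X} → T ≅ R → ∀ p → subAt R p ≡ just X → Tracked T X (ancestors R p)
tracked-≅ T≅R p eq with ≅-subAt (≅-sym T≅R) p eq
... | p′ , S′ , eq′ , X≅S′ , as≡ = tracked p′ S′ eq′ (sym (≅-size X≅S′)) (sym (≅-idOf X≅S′)) (sym as≡)

Tracked-resp : ∀ {T S X as} → size S ≡ size X → idOf S ≡ idOf X → Tracked T S as → Tracked T X as
Tracked-resp size≡ idOf≡ (tracked p S′ sub size-S′ idOf-S′ as≡) =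
  tracked p S′ sub (trans size-S′ size≡) (trans idOf-S′ idOf≡) as≡

tracked-profile : ∀ {T X as q} → Unique (ids T) → Tracked T X as → pathTo (idOf X) T ≡ just q → Profile T q X as
tracked-profile {T} {X} {q = q} uq (tracked p S sub size-S idOf-S refl) path-X
  with refl ← pathTo-unique p uq path-X (trans (cong (Maybe.map idOf) sub) (cong just idOf-S)) = record
  { length-path     = length-path
  ; size-at         = λ i → trans (size-at i) (cong (λ s → clampedLookup s (map ancSize (ancestors T q)) i) size-S)
  ; id-at           = λ i → trans (id-at i) (cong (λ s → just (clampedLookup s (map ancId (ancestors T q)) i)) idOf-S)
  ; sibling-size-at = sibling-size-at
  }
  where open Profile (profile {T} {q} sub)

-- rotate_up(u) replaces the subtree Old = z(y(u, a), b) by New = z(u, y(a, b)), up to reorientation.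
module RotationShape (d₁ d₂ : Dir) (z y : ℕ) (Z₁ Z₂ Y₁ Y₂ : Tree) (pick≡Y : pick d₁ Z₁ Z₂ ≡ node y Y₁ Y₂) where
  Old Y U A B Y′ New : Tree
  Old = node z Z₁ Z₂
  Y   = node y Y₁ Y₂
  U   = pick d₂ Y₁ Y₂
  A   = pick (flip d₂) Y₁ Y₂
  B   = pick (flip d₁) Z₁ Z₂
  Y′  = node y A B
  New = node z U Y′

  size-Old : size Old ≡ size Y + size B
  size-Old rewrite size-pick z Z₁ Z₂ d₁ | pick≡Y = refl

  size-New : size New ≡ size Old
  size-New rewrite size-node z U Y′ | size-node y A B | size-Old | size-pick y Y₁ Y₂ d₂ = sym (+-assoc (size U) (size A) (size B))

  ids-New : ids New ↭ ids Old
  ids-New = ↭-sym (↭-trans (ids-pick z Z₁ Z₂ d₁) (prep z (begin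
    ids (pick d₁ Z₁ Z₂) ++ ids B        ≡⟨ cong (λ t → ids t ++ ids B) pick≡Y ⟩
    (y ∷ ids Y₁ ++ ids Y₂) ++ ids B     ↭⟨ ++⁺ʳ (ids B) (ids-pick y Y₁ Y₂ d₂) ⟩
    (y ∷ ids U ++ ids A) ++ ids B       ≡⟨ cong (y ∷_) (++-assoc (ids U) (ids A) (ids B)) ⟩
    y ∷ ids U ++ ids A ++ ids B         ↭⟨ shift y (ids U) (ids A ++ ids B) ⟨
    ids U ++ y ∷ ids A ++ ids B         ∎)))
    where open PermutationReasoning

  prodNodes-New : prodNodes New * size Y ≡ prodNodes Old * size Y′
  prodNodes-New rewrite prodNodes-pick z Z₁ Z₂ d₁ | pick≡Y | prodNodes-pick y Y₁ Y₂ d₂ | size-New =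
    solve 6 (λ o y y′ u a b → o :* u :* (y′ :* a :* b) :* y := o :* (y :* u :* a) :* b :* y′) refl
      (size Old) (size Y) (size Y′) (prodNodes U) (prodNodes A) (prodNodes B)

  subAt-Old-U : ∀ s → subAt Old (d₁ ∷ d₂ ∷ s) ≡ subAt U s
  subAt-Old-U s rewrite subAt-node z Z₁ Z₂ d₁ (d₂ ∷ s) | pick≡Y = subAt-node y Y₁ Y₂ d₂ s

  ancestors-Old-U : ∀ s → ancestors Old (d₁ ∷ d₂ ∷ s)
                        ≡ ancestors U s ++ ancestor (size Y) y (size A) ∷ ancestor (size Old) z (size B) ∷ []
  ancestors-Old-U s rewrite pick≡Y = ++-assoc (ancestors U s) _ _

  subAt-Old-A : ∀ s → subAt Old (d₁ ∷ flip d₂ ∷ s) ≡ subAt A s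
  subAt-Old-A s rewrite subAt-node z Z₁ Z₂ d₁ (flip d₂ ∷ s) | pick≡Y = subAt-node y Y₁ Y₂ (flip d₂) s

  ancestors-Old-A : ∀ s → ancestors Old (d₁ ∷ flip d₂ ∷ s)
                        ≡ ancestors A s ++ ancestor (size Y) y (size U) ∷ ancestor (size Old) z (size B) ∷ []
  ancestors-Old-A s rewrite pick≡Y | flip-involutive d₂ = ++-assoc (ancestors A s) _ _

  replaceAt-potential : ∀ {T c T′} → subAt T c ≡ just Old → T′ ≅ replaceAt T c New →
    prodNodes T′ * size Y ≡ prodNodes T * size Y′
  replaceAt-potential {T} {c} {T′} sub T′≅ = *-cancelʳ-≡ _ _ (prodNodes Old) {{>-nonZero (prodNodes>0 Old)}} (begin
    prodNodes T′ * size Y * prodNodes Old         ≡⟨ cong (λ p → p * size Y * prodNodes Old) (≅-prodNodes T′≅) ⟩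
    prodNodes T₀ * size Y * prodNodes Old          ≡⟨ solve 3 (λ r y o → r :* y :* o := r :* o :* y) refl (prodNodes T₀) (size Y) (prodNodes Old) ⟩
    prodNodes T₀ * prodNodes Old * size Y          ≡⟨ cong (_* size Y) (prodNodes-replaceAt size-New T c sub) ⟩
    prodNodes T * prodNodes New * size Y          ≡⟨ *-assoc (prodNodes T) _ _ ⟩
    prodNodes T * (prodNodes New * size Y)        ≡⟨ cong (prodNodes T *_) prodNodes-New ⟩
    prodNodes T * (prodNodes Old * size Y′)       ≡⟨ solve 3 (λ t o y → t :* (o :* y) := t :* y :* o) refl (prodNodes T) (prodNodes Old) (size Y′) ⟩
    prodNodes T * size Y′ * prodNodes Old         ∎)
    where
    open ≡-Reasoning
    T₀ : Tree
    T₀ = replaceAt T c New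

  replaceAt-tracked : ∀ {T c T′ X} s → subAt T c ≡ just Old → T′ ≅ replaceAt T c New → subAt New s ≡ just X →
    Tracked T′ X (ancestors New s ++ ancestors T c)
  replaceAt-tracked {T} {c} {T′} {X} s sub T′≅ eq =
    subst (Tracked T′ X) (ancestors-replaceAt size-New T c s sub) (tracked-≅ T′≅ (c ++ s) (trans (subAt-replaceAt T c s sub) eq))

record AncestorRotation (T T′ : Tree) (q : List Dir) (X : Tree) (m : ℕ) : Set where
  field
    W Z              : List Ancestor
    e₁ e₂            : Ancestor
    length-W         : length W ≡ m
    ancestors-before : ancestors T q ≡ W ++ e₁ ∷ e₂ ∷ Z
    after            : Tracked T′ X (W ++ ancestor (ancSize e₂) (ancId e₂) (offPathSize e₁ + offPathSize e₂) ∷ Z)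
    potential        : prodNodes T′ * ancSize e₁ ≡ prodNodes T * (offPathSize e₁ + offPathSize e₂)

record SiblingRotation (T T′ : Tree) (q : List Dir) (X : Tree) (k : ℕ) : Set where
  field
    W Z              : List Ancestor
    e₁ e₂            : Ancestor
    w                : ℕ
    w>0              : 0 < w
    length-W         : length W ≡ k
    ancestors-before : ancestors T q ≡ W ++ e₁ ∷ e₂ ∷ Z
    after            : Tracked T′ X (W ++ ancestor w (ancId e₁) (offPathSize e₂)
                                       ∷ ancestor (ancSize e₂) (ancId e₂) (offPathSize e₁) ∷ Z)
    potential        : prodNodes T′ * ancSize e₁ ≡ prodNodes T * w

record DoubleRotation (T T′ : Tree) (q : List Dir) (X : Tree) (k : ℕ) : Set where
  field
    W Z              : List Ancestor
    e₁ e₂ e₃         : Ancestor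
    w                : ℕ
    w>0              : 0 < w
    length-W         : length W ≡ k
    ancestors-before : ancestors T q ≡ W ++ e₁ ∷ e₂ ∷ e₃ ∷ Z
    after            : Tracked T′ X ((W ∷ʳ ancestor w (ancId e₁) (offPathSize e₂))
                                     ++ ancestor (ancSize e₃) (ancId e₃) (offPathSize e₁ + offPathSize e₃) ∷ Z)
    potential        : prodNodes T′ * ancSize e₂ * ancSize e₁ ≡ prodNodes T * w * (offPathSize e₁ + offPathSize e₃)

module _ {Fe : List Edge} {ex : ℕ → Bool} where
  open Ctx Fe ex

  Rot-Unique : ∀ {T u T′} → Unique (ids T) → Rot T u T′ → Unique (ids T′)
  Rot-Unique {T} uq (rot c d₁ d₂ z y Z₁ Z₂ Y₁ Y₂ _ sub pick≡Y _ T′≅ _) =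
    Unique-resp-↭ (↭⇒↭ₛ (↭-sym (↭-trans (≅-ids T′≅) (ids-replaceAt T c sub ids-New)))) uq
    where open RotationShape d₁ d₂ z y Z₁ Z₂ Y₁ Y₂ pick≡Y

  rotate-ancestor : ∀ {T u T′} → Unique (ids T) → Rot T u T′ → ∀ {q X m} → subAt T q ≡ just X → idAt T (anc m q) ≡ just u →
    AncestorRotation T T′ q X m
  rotate-ancestor {T} {T′ = T′} uq (rot c d₁ d₂ z y Z₁ Z₂ Y₁ Y₂ path-u sub pick≡Y _ T′≅ _) {q} {X} {m} sX eu
    with anc≡ ← pathTo-unique (anc m q) uq path-u eu
    with t , anc++t≡q , |t|≡m ← anc-split m q (<⇒≤ (anc-++-∷⇒< m q c (sym anc≡))) = record
    { W = ancestors U t ; Z = ancestors T c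
    ; e₁ = ancestor (size Y) y (size A) ; e₂ = ancestor (size Old) z (size B)
    ; length-W = trans (length-ancestors U t sU) |t|≡m
    ; ancestors-before = begin
        ancestors T q                                  ≡⟨ cong (ancestors T) q≡ ⟨
        ancestors T (c ++ d₁ ∷ d₂ ∷ t)                  ≡⟨ ancestors-++ T c (d₁ ∷ d₂ ∷ t) sub ⟩
        ancestors Old (d₁ ∷ d₂ ∷ t) ++ ancestors T c    ≡⟨ cong (_++ ancestors T c) (ancestors-Old-U t) ⟩
        (ancestors U t ++ _) ++ ancestors T c           ≡⟨ ++-assoc (ancestors U t) _ _ ⟩
        _                                              ∎
    ; after = subst (Tracked T′ X) (trans (++-assoc (ancestors U t) _ _)
                (cong₂ (λ s s′ → ancestors U t ++ ancestor s z s′ ∷ ancestors T c) size-New (size-node y A B)))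
                (replaceAt-tracked (L ∷ t) sub T′≅ sU)
    ; potential = trans (replaceAt-potential sub T′≅) (cong (prodNodes T *_) (size-node y A B))
    }
    where
    open RotationShape d₁ d₂ z y Z₁ Z₂ Y₁ Y₂ pick≡Y
    open ≡-Reasoning
    q≡ : c ++ d₁ ∷ d₂ ∷ t ≡ q
    q≡ = trans (sym (++-assoc c (d₁ ∷ d₂ ∷ []) t)) (trans (cong (_++ t) anc≡) anc++t≡q)
    sU : subAt U t ≡ just X
    sU = trans (sym (subAt-Old-U t)) (trans (sym (subAt-++ T c (d₁ ∷ d₂ ∷ t) sub)) (trans (cong (subAt T) q≡) sX))

  rotate-sibling : ∀ {T u T′} → Unique (ids T) → Rot T u T′ → ∀ {q X k P d} → subAt T q ≡ just X →
    anc k q ≡ P ∷ʳ d → idAt T (P ∷ʳ flip d) ≡ just u → SiblingRotation T T′ q X k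
  rotate-sibling {T} {T′ = T′} uq (rot c d₁ d₂ z y Z₁ Z₂ Y₁ Y₂ path-u sub pick≡Y _ T′≅ _) {q} {X} {k} {P} {d} sX anc≡ eu
    with path≡ ← pathTo-unique (P ∷ʳ flip d) uq path-u eu
    with refl , refl ← ∷ʳ-injective (c ∷ʳ d₁) P (trans (++-assoc c (d₁ ∷ []) (d₂ ∷ [])) path≡)
    with t , anc++t≡q , |t|≡k ← anc-split k q (<⇒≤ (anc-++-∷⇒< k q P anc≡)) = record
    { W = ancestors A t ; Z = ancestors T c
    ; e₁ = ancestor (size Y) y (size U) ; e₂ = ancestor (size Old) z (size B)
    ; w = size Y′ ; w>0 = size>0 Y′
    ; length-W = trans (length-ancestors A t sA) |t|≡k
    ; ancestors-before = begin
        ancestors T q                                    ≡⟨ cong (ancestors T) q≡ ⟨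
        ancestors T (c ++ d₁ ∷ flip d₂ ∷ t)               ≡⟨ ancestors-++ T c (d₁ ∷ flip d₂ ∷ t) sub ⟩
        ancestors Old (d₁ ∷ flip d₂ ∷ t) ++ ancestors T c ≡⟨ cong (_++ ancestors T c) (ancestors-Old-A t) ⟩
        (ancestors A t ++ _) ++ ancestors T c             ≡⟨ ++-assoc (ancestors A t) _ _ ⟩
        _                                                ∎
    ; after = subst (Tracked T′ X)
                (trans (++-assoc (ancestors A t ∷ʳ _) _ _) (trans (++-assoc (ancestors A t) _ _)
                  (cong (λ s → ancestors A t ++ ancestor (size Y′) y (size B) ∷ ancestor s z (size U) ∷ ancestors T c) size-New)))
                (replaceAt-tracked (R ∷ L ∷ t) sub T′≅ sA)
    ; potential = replaceAt-potential sub T′≅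
    }
    where
    open RotationShape d₁ d₂ z y Z₁ Z₂ Y₁ Y₂ pick≡Y
    open ≡-Reasoning
    q≡ : c ++ d₁ ∷ flip d₂ ∷ t ≡ q
    q≡ = begin
      c ++ d₁ ∷ flip (flip d) ∷ t   ≡⟨ cong (λ e → c ++ d₁ ∷ e ∷ t) (flip-involutive d) ⟩
      c ++ d₁ ∷ d ∷ t               ≡⟨ trans (++-assoc (c ∷ʳ d₁) (d ∷ []) t) (++-assoc c (d₁ ∷ []) (d ∷ t)) ⟨
      ((c ∷ʳ d₁) ∷ʳ d) ++ t         ≡⟨ cong (_++ t) anc≡ ⟨
      anc k q ++ t                  ≡⟨ anc++t≡q ⟩
      q                             ∎
    sA : subAt A t ≡ just X
    sA = trans (sym (subAt-Old-A t)) (trans (sym (subAt-++ T c (d₁ ∷ flip d₂ ∷ t) sub)) (trans (cong (subAt T) q≡) sX))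

  rotate-sibling-then-parent : ∀ {T u₁ T₁ u₂ T′} → Unique (ids T) → Rot T u₁ T₁ → Rot T₁ u₂ T′ →
    ∀ {q X k P d} → subAt T q ≡ just X → anc k q ≡ P ∷ʳ d → idAt T (P ∷ʳ flip d) ≡ just u₁ → idAt T (anc (suc k) q) ≡ just u₂ → DoubleRotation T T′ q X k
  rotate-sibling-then-parent {T} {T₁ = T₁} {T′ = T′} uq rt₁ rt₂ {q} {X} {k} sX anc≡ u₁-at u₂-at
    with record { W = W ; Z = Z ; e₁ = e₁ ; e₂ = e₂ ; w = w ; w>0 = w>0 ; length-W = refl ; ancestors-before = before
                ; after = tracked p S sub size-S idOf-S mid ; potential = pot₁ } ← rotate-sibling uq rt₁ {q} {k = k} sX anc≡ u₁-at
    with record { W = W′ ; Z = Z′ ; e₂ = f ; length-W = |W′| ; ancestors-before = mid′ ; after = after ; potential = pot₂ }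
           ← rotate-ancestor (Rot-Unique uq rt₁) rt₂ {p} {m = suc (length W)} sub
               -- the first rotation leaves p = p_{k+1}(x) on the ancestor chain of x
               (trans (profile-ancId (subst (Profile T₁ p S) mid (profile sub)) 0)
                 (trans (sym (profile-ancId (subst (Profile T q X) before (profile sX)) 0)) u₂-at))
    with refl , refl ← ++-cancel-length (W ∷ʳ ancestor w (ancId e₁) (offPathSize e₂)) W′ (trans (length-∷ʳ W _) (sym |W′|))
                         (trans (++-assoc W _ _) (trans (sym mid) mid′)) = record
    { W = W ; Z = Z′ ; e₁ = e₁ ; e₂ = e₂ ; e₃ = f ; w = w ; w>0 = w>0 ; length-W = refl
    ; ancestors-before = before
    ; after = Tracked-resp size-S idOf-S after
    ; potential = begin
        prodNodes T′ * ancSize e₂ * ancSize e₁   ≡⟨ cong (_* ancSize e₁) pot₂ ⟩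
        prodNodes T₁ * σ * ancSize e₁            ≡⟨ solve 3 (λ p s u → p :* s :* u := p :* u :* s) refl (prodNodes T₁) σ (ancSize e₁) ⟩
        prodNodes T₁ * ancSize e₁ * σ            ≡⟨ cong (_* σ) pot₁ ⟩
        prodNodes T * w * σ                      ∎
    }
    where
    open ≡-Reasoning
    σ : ℕ
    σ = offPathSize e₁ + offPathSize f

module _ {Fe : List Edge} {ex : ℕ → Bool} where
  open Ctx Fe ex

  module SemiSplayStep {T T′ : Tree} (uq : Unique (ids T)) {q q′ : List Dir} {X : Tree} (sX : subAt T q ≡ just X)
    (path′ : pathTo (idOf X) T′ ≡ just q′) {a b ℓ : ℕ} (ℓ≤b : ℓ ≤ b) (ℓ≤ : ℓ ≤ length q′) where

    Goal : Set
    Goal = prodNodes T′ * prodRange (λ i → szAt T (anc i q)) a (suc b)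
         ≡ prodNodes T * szSib T′ (anc (ℓ ∸ 1) q′) * prodRange (λ i → szAt T′ (anc i q′)) a b

    returned-index : Unique (ids T′) → ∀ {W e Z} → Profile T′ q′ X (W ++ e ∷ Z) →
      idAt T′ (anc ℓ q′) ≡ just (ancId e) → ℓ ≡ suc (length W)
    returned-index uq′ {W} {e} {Z} new r-at =
      anc-injective q′ ℓ≤ ≤length (idAt-injective T′ uq′ _ _ r-at (profile-ancId new 0))
      where
      open Profile new
      ≤length : suc (length W) ≤ length q′
      ≤length = subst (suc (length W) ≤_) (sym (trans length-path (length-++ W))) (m<m+n (length W) (s≤s z≤n))

    goal-via-profiles : ∀ {as W e Z} → Profile T q X as → Profile T′ q′ X (W ++ e ∷ Z) → ℓ ≡ suc (length W) →
      prodNodes T′ * prodRange (clampedLookup (size X) (map ancSize as)) a (suc b)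
        ≡ prodNodes T * offPathSize e * prodRange (clampedLookup (size X) (map ancSize (W ++ e ∷ Z))) a b →
      Goal
    goal-via-profiles {as} {W} {e} {Z} old new ℓ≡ eq = begin
      prodNodes T′ * prodRange (λ i → szAt T (anc i q)) a (suc b)
        ≡⟨ cong (prodNodes T′ *_) (prodRange-cong a (suc b) (λ {i} _ → Profile.size-at old i)) ⟩
      prodNodes T′ * prodRange (clampedLookup (size X) (map ancSize as)) a (suc b)
        ≡⟨ eq ⟩
      prodNodes T * offPathSize e * prodRange (clampedLookup (size X) (map ancSize (W ++ e ∷ Z))) a b
        ≡⟨ cong₂ (λ s p → prodNodes T * s * p) sibling (prodRange-cong a b (λ {i} _ → Profile.size-at new i)) ⟨
      prodNodes T * szSib T′ (anc (ℓ ∸ 1) q′) * prodRange (λ i → szAt T′ (anc i q′)) a b ∎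
      where
      open ≡-Reasoning
      sibling : szSib T′ (anc (ℓ ∸ 1) q′) ≡ offPathSize e
      sibling = begin
        szSib T′ (anc (ℓ ∸ 1) q′)                                ≡⟨ cong (λ n → szSib T′ (anc (n ∸ 1) q′)) ℓ≡ ⟩
        szSib T′ (anc (length W) q′)                             ≡⟨ Profile.sibling-size-at new (subst (_≤ length q′) ℓ≡ ℓ≤) ⟩
        clampedLookup 0 (map offPathSize (W ++ e ∷ Z)) (suc (length W)) ≡⟨ clampedLookup-map-++-∷ offPathSize 0 W e Z 0 ⟩
        offPathSize e                                            ∎

    single : ∀ {u m r} → Rot T u T′ → idAt T (anc m q) ≡ just u → idAt T (anc (suc (suc m)) q) ≡ just r →
      idAt T′ (anc ℓ q′) ≡ just r → a ≤ suc m → Goal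
    single {m = m} rt u-at r-at-old r-at a≤
      with record { W = W ; Z = Z ; e₁ = e₁ ; e₂ = e₂ ; length-W = refl ; ancestors-before = before ; after = after ; potential = pot }
             ← rotate-ancestor uq rt {q} {m = m} sX u-at =
      goal-via-profiles old new ℓ≡
        (subst₂ (λ l l′ → prodNodes T′ * prodRange (clampedLookup (size X) l) a (suc b)
                          ≡ prodNodes T * σ * prodRange (clampedLookup (size X) l′) a b)
          (sym (map-++ ancSize W _)) (sym (map-++ ancSize W _))
          (potential-single (prodNodes T) (prodNodes T′) (size X) (map ancSize W) (ancSize e₁) (ancSize e₂) (map ancSize Z) σ pot
            (subst (λ n → a ≤ suc n) (sym (length-map ancSize W)) a≤)
            (subst (λ n → suc n ≤ b) (sym (length-map ancSize W)) (subst (_≤ b) ℓ≡ ℓ≤b))))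
      where
      σ : ℕ
      σ = offPathSize e₁ + offPathSize e₂
      old : Profile T q X (W ++ e₁ ∷ e₂ ∷ Z)
      old = subst (Profile T q X) before (profile sX)
      uq′ : Unique (ids T′)
      uq′ = Rot-Unique uq rt
      new : Profile T′ q′ X (W ++ ancestor (ancSize e₂) (ancId e₂) σ ∷ Z)
      new = tracked-profile uq′ after path′
      ℓ≡ : ℓ ≡ suc (length W)
      ℓ≡ = returned-index uq′ new (trans r-at (trans (sym r-at-old) (profile-ancId old 1)))

    double : ∀ {u₁ T₁ u₂ k P d r} → Rot T u₁ T₁ → Rot T₁ u₂ T′ → anc k q ≡ P ∷ʳ d → idAt T (P ∷ʳ flip d) ≡ just u₁ →
      idAt T (anc (suc k) q) ≡ just u₂ → idAt T (anc (suc (suc (suc k))) q) ≡ just r → idAt T′ (anc ℓ q′) ≡ just r →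
      a ≤ suc k → Goal
    double {k = k} rt₁ rt₂ anc≡ u₁-at u₂-at r-at-old r-at a≤
      with record { W = W ; Z = Z ; e₁ = e₁ ; e₂ = e₂ ; e₃ = e₃ ; w = w ; w>0 = w>0 ; length-W = refl
                  ; ancestors-before = before ; after = after ; potential = pot }
             ← rotate-sibling-then-parent uq rt₁ rt₂ {q} {k = k} sX anc≡ u₁-at u₂-at =
      goal-via-profiles old new ℓ≡
        (subst₂ (λ l l′ → prodNodes T′ * prodRange (clampedLookup (size X) l) a (suc b)
                          ≡ prodNodes T * σ * prodRange (clampedLookup (size X) l′) a b)
          (sym (map-++ ancSize W _)) (sym (trans (cong (map ancSize) (++-assoc W _ _)) (map-++ ancSize W _)))
          (potential-double (prodNodes T) (prodNodes T′) (size X) (map ancSize W) (ancSize e₁) (ancSize e₂) (map ancSize Z) σ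
            (ancSize e₃) w pot w>0
            (subst (λ n → a ≤ suc n) (sym (length-map ancSize W)) a≤)
            (subst (λ n → suc (suc n) ≤ b) (sym (length-map ancSize W)) (subst (_≤ b) (trans ℓ≡ (cong suc (length-∷ʳ W _))) ℓ≤b))))
      where
      σ : ℕ
      σ = offPathSize e₁ + offPathSize e₃
      old : Profile T q X (W ++ e₁ ∷ e₂ ∷ e₃ ∷ Z)
      old = subst (Profile T q X) before (profile sX)
      uq′ : Unique (ids T′)
      uq′ = Rot-Unique (Rot-Unique uq rt₁) rt₂
      new : Profile T′ q′ X ((W ∷ʳ ancestor w (ancId e₁) (offPathSize e₂)) ++ ancestor (ancSize e₃) (ancId e₃) σ ∷ Z)
      new = tracked-profile uq′ after path′
      ℓ≡ : ℓ ≡ suc (length (W ∷ʳ ancestor w (ancId e₁) (offPathSize e₂)))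
      ℓ≡ = returned-index uq′ new (trans r-at (trans (sym r-at-old) (profile-ancId old 2)))

    located : ∀ {pk} k {p} → pathTo pk T ≡ just p → idAt T (anc k q) ≡ just pk → anc k q ≡ p
    located k path-pk pk-at = sym (pathTo-unique (anc k q) uq path-pk pk-at)

    ancestor-id : ∀ k P s {S} → anc k q ≡ P ++ s → subAt T P ≡ just S → idAt T (anc (length s + k) q) ≡ just (idOf S)
    ancestor-id k P s eq sS = trans (cong (idAt T) (anc-++ k q P s eq)) (subAt⇒idAt T P sS)

    semi-splay-step : ∀ {pk k r} → Step T pk T′ (just r) → idAt T (anc k q) ≡ just pk → idAt T′ (anc ℓ q′) ≡ just r →
      a ≤ suc k → Goal
    semi-splay-step {k = k} (zig q₀ d₁ d₂ _ G _ path-x _ sG _ _ rt) pk-at r-at a≤ =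
      single rt pk-at (ancestor-id k q₀ (d₁ ∷ d₂ ∷ []) (located k path-x pk-at) sG) r-at a≤
    semi-splay-step {k = k} (case1 q₀ d₀ d₁ d₂ _ _ G _ _ (path-x , _ , _ , sG , _) _ _ _ rt) pk-at r-at a≤ =
      single rt pk-at (ancestor-id k (q₀ ∷ʳ d₀) (d₁ ∷ d₂ ∷ []) (trans (located k path-x pk-at) (sym (++-assoc q₀ _ _))) sG) r-at a≤
    semi-splay-step {k = k} (case2 q₀ d₀ d₁ d₂ _ P _ GG _ (path-x , _ , sP , _ , sGG) _ _ _ _ rt) pk-at r-at a≤ =
      single rt (ancestor-id k (q₀ ++ d₀ ∷ d₁ ∷ []) (d₂ ∷ []) (trans (located k path-x pk-at) (sym (++-assoc q₀ _ _))) sP)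
        (ancestor-id k q₀ (d₀ ∷ d₁ ∷ d₂ ∷ []) (located k path-x pk-at) sGG) r-at (m≤n⇒m≤1+n a≤)
    semi-splay-step {k = k} (case3 q₀ d₀ d₁ d₂ _ P _ GG S _ _ (path-x , _ , sP , _ , sGG) _ _ _ _ sS rt₁ rt₂) pk-at r-at a≤ =
      double rt₁ rt₂ anc≡
        (subAt⇒idAt T ((q₀ ++ d₀ ∷ d₁ ∷ []) ∷ʳ flip d₂) (trans (cong (subAt T) (++-assoc q₀ (d₀ ∷ d₁ ∷ []) (flip d₂ ∷ []))) sS))
        (ancestor-id k (q₀ ++ d₀ ∷ d₁ ∷ []) (d₂ ∷ []) anc≡ sP)
        (ancestor-id k q₀ (d₀ ∷ d₁ ∷ d₂ ∷ []) (located k path-x pk-at) sGG) r-at a≤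
      where
      anc≡ : anc k q ≡ (q₀ ++ d₀ ∷ d₁ ∷ []) ∷ʳ d₂
      anc≡ = trans (located k path-x pk-at) (sym (++-assoc q₀ _ _))
    semi-splay-step {k = k} (recurse q₀ d₀ d₁ d₂ _ P _ _ _ _ (path-x , _ , sP , _ , _) _ _ inner) pk-at r-at a≤ =
      semi-splay-step inner
        (ancestor-id k (q₀ ++ d₀ ∷ d₁ ∷ []) (d₂ ∷ []) (trans (located k path-x pk-at) (sym (++-assoc q₀ _ _))) sP)
        r-at (m≤n⇒m≤1+n a≤)

Unique-lookup-ids : ∀ (ts : List Tree) (t : Fin (length ts)) → Unique (concatMap ids ts) → Unique (ids (lookup ts t))
Unique-lookup-ids (T ∷ ts) zero    u = Unique-++⁻ˡ (ids T) u
Unique-lookup-ids (T ∷ ts) (suc t) u = Unique-lookup-ids ts t (Unique-++⁻ʳ (ids T) u)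

expΦ-∷= : ∀ (ts : List Tree) (t : Fin (length ts)) T′ {m n} → prodNodes T′ * m ≡ prodNodes (lookup ts t) * n →
  expΦ (ts [ t ]∷= T′) * m ≡ expΦ ts * n
expΦ-∷= (T ∷ ts) zero    T′ {m} {n} eq = begin
  prodNodes T′ * expΦ ts * m   ≡⟨ solve 3 (λ p e m → p :* e :* m := e :* (p :* m)) refl (prodNodes T′) (expΦ ts) m ⟩
  expΦ ts * (prodNodes T′ * m) ≡⟨ cong (expΦ ts *_) eq ⟩
  expΦ ts * (prodNodes T * n)  ≡⟨ solve 3 (λ e p n → e :* (p :* n) := p :* e :* n) refl (expΦ ts) (prodNodes T) n ⟩
  prodNodes T * expΦ ts * n    ∎
  where open ≡-Reasoning
expΦ-∷= (T ∷ ts) (suc t) T′ eq =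
  trans (*-assoc (prodNodes T) _ _) (trans (cong (prodNodes T *_) (expΦ-∷= ts t T′ eq)) (sym (*-assoc (prodNodes T) _ _)))

lemma5p4 : (ex : ℕ → Bool) (ts : List Tree) (t : Fin (length ts)) (x : ℕ)
    (q q' : List Dir) (k a b ℓ pk r : ℕ) (T' : Tree) →
    IsTopForest ex ts →
    Ctx.OI (allEdges ts) ex (lookup ts t) →
    pathTo x (lookup ts t) ≡ just q →
    k ≤ b → a ≤ suc k →
    idAt (lookup ts t) (anc k q) ≡ just pk →
    Ctx.Step (allEdges ts) ex (lookup ts t) pk T' (just r) →
    pathTo x T' ≡ just q' →
    ℓ ≤ b → ℓ ≤ length q' →
    idAt T' (anc ℓ q') ≡ just r →
    expΦ (ts [ t ]∷= T') * prodRange (λ i → szAt (lookup ts t) (anc i q)) a (suc b)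
      ≡ expΦ ts * szSib T' (anc (ℓ ∸ 1) q') * prodRange (λ i → szAt T' (anc i q')) a b
-- The hypothesis k ≤ b is implied by ℓ ≤ b: the returned node lies strictly above p_k(x).
lemma5p4 ex ts t x q q′ k a b ℓ pk r T′ (uq , _ , _) _ path-x _ a≤ pk-at splay path-x′ ℓ≤b ℓ≤ r-at
  with X , sX , refl ← idAt-subAt (lookup ts t) q (pathTo-idAt x (lookup ts t) path-x) =
  trans (expΦ-∷= ts t T′ (trans (SemiSplayStep.semi-splay-step (Unique-lookup-ids ts t uq) sX path-x′ ℓ≤b ℓ≤ splay pk-at r-at a≤)
                                (*-assoc (prodNodes (lookup ts t)) _ _)))
        (sym (*-assoc (expΦ ts) _ _))
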